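{- Let $G$ be a connected graph on $n$ vertices, and suppose the algorithm $\textsc{CongSpanTree}$ (described in the context) uses in step 3 a subroutine that, for every input graph $H$ arising during the recursion, returns a $2/3$-balanced cut of $H$ whose number of crossing edges is at most $\alpha(n)\cdot b(H)$. Let $T=\textsc{CongSpanTree}(G)$. Then $c(G,T)\le \mathcal{O}(\alpha(n)\cdot\log n)\cdot hb(G)$.
   Context: For a connected graph $G$ and a spanning tree $T$ of $G$: for a tree edge $uv$, let $S_u,S_v$ be the vertex sets of the two components of $T$ minus $uv$; the congestion $c(uv)$ is the number of edges of $G$ between $S_u$ and $S_v$, and $c(G,T)=\max_{e\in E(T)}c(e)$. A bisection of a graph on $m$ vertices is a partition of its vertices into two sets each of size at most $\lceil m/2\rceil$; $b(H)$ is the minimum number of edges crossing a bisection of $H$, and the hereditary bisection width $hb(G)$ is the maximum of $b(H)$ over all subgraphs $H$ of $G$. A $2/3$-balanced cut of a graph on $m$ vertices is a partition of its vertices into two sets each of size at most $2m/3$. Algorithm $\textsc{CongSpanTree}(H)$: (1) if $H$ has one vertex, return $H$; (2) otherwise compute a $2/3$-balanced cut $(S,V(H)\setminus S)$ of $H$ with the subroutine (step 3), and let $F$ be the set of edges crossing it; (3) for each connected component $C$ of $H$ with the edges of $F$ removed, recursively compute $T_C=\textsc{CongSpanTree}(C)$; (4) connect all trees $T_C$ arbitrarily by edges of $F$ into a spanning tree $T$ of $H$ and return $T$. -}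

module Defs where

open import Data.Nat using (ℕ; zero; suc; _+_; _*_; _≤_; _<ᵇ_; ⌈_/2⌉)
open import Data.Nat.Logarithm using (⌈log₂_⌉)
open import Data.Bool using (Bool; true; false; _∧_; _∨_; _xor_; not; if_then_else_)
open import Data.Fin using (Fin; toℕ; _≟_)
open import Data.List using (List; map; allFin)
open import Data.Nat.ListAction using (sum)
open import Data.Product using (Σ; _×_; _,_)
open import Relation.Nullary using (¬_)
open import Relation.Nullary.Decidable using (⌊_⌋)
open import Relation.Binary.PropositionalEquality using (_≡_)
open import Function.Bundles using (_⇔_)

VSet : ℕ → Set
VSet n = Fin n → Bool

ESet : ℕ → Set
ESet n = Fin n → Fin n → Bool

record Graph (n : ℕ) : Set where
  field
    adj    : ESet n
    sym    : ∀ i j → adj i j ≡ adj j i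
    irrefl : ∀ i → adj i i ≡ false
open Graph public

full : ∀ {n} → VSet n
full _ = true

size : ∀ {n} → VSet n → ℕ
size {n} X = sum (map (λ i → if X i then 1 else 0) (allFin n))

countE : ∀ {n} → ESet n → ℕ
countE {n} E = sum (map (λ i → sum (map (λ j → if (toℕ i <ᵇ toℕ j) ∧ E i j then 1 else 0)
                                        (allFin n))) (allFin n))

_⊆_ : ∀ {n} → VSet n → VSet n → Set
X ⊆ Y = ∀ i → X i ≡ true → Y i ≡ true

_∖_ : ∀ {n} → VSet n → VSet n → VSet n
(X ∖ S) i = X i ∧ not (S i)

crossing : ∀ {n} → ESet n → VSet n → ESet n
crossing E S i j = E i j ∧ (S i xor S j)

induced : ∀ {n} → Graph n → VSet n → ESet n
induced G X i j = X i ∧ X j ∧ adj G i j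

restrict : ∀ {n} → ESet n → VSet n → ESet n
restrict T C i j = C i ∧ C j ∧ T i j

eqF : ∀ {n} → Fin n → Fin n → Bool
eqF i j = ⌊ i ≟ j ⌋

removeEdge : ∀ {n} → ESet n → Fin n → Fin n → ESet n
removeEdge T u v i j = T i j ∧ not ((eqF i u ∧ eqF j v) ∨ (eqF i v ∧ eqF j u))

data Path {n : ℕ} (E : ESet n) : Fin n → Fin n → Set where
  here : ∀ {i} → Path E i i
  step : ∀ {i j k} → E i j ≡ true → Path E j k → Path E i k

Connected : ∀ {n} → VSet n → ESet n → Set
Connected X E = ∀ i j → X i ≡ true → X j ≡ true → Path E i j

ConnectedGraph : ∀ {n} → Graph n → Set
ConnectedGraph G = Connected full (adj G)

-- T is a spanning tree of the graph (X, E): a connected, acyclic (every edge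
-- is a bridge) subgraph of (X,E) on all of X.
IsSpanningTree : ∀ {n} → VSet n → ESet n → ESet n → Set
IsSpanningTree X E T =
  (∀ i j → T i j ≡ true → E i j ≡ true) ×
  (∀ i j → T i j ≡ T j i) ×
  Connected X T ×
  (∀ u v → T u v ≡ true → ¬ Path (removeEdge T u v) u v)

IsComponent : ∀ {n} → VSet n → ESet n → VSet n → Set
IsComponent {n} X E C = Σ (Fin n) λ c → X c ≡ true × (∀ w → (C w ≡ true) ⇔ Path E c w)

record SubGraph {n : ℕ} (G : Graph n) : Set where
  field
    V     : VSet n
    E     : ESet n
    E-sym : ∀ i j → E i j ≡ E j i
    E-sub : ∀ i j → E i j ≡ true → adj G i j ≡ true × V i ≡ true × V j ≡ true
open SubGraph public

IsBisection : ∀ {n} → VSet n → VSet n → Set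
IsBisection V A = A ⊆ V × size A ≤ ⌈ size V /2⌉ × size (V ∖ A) ≤ ⌈ size V /2⌉

IsBW : ∀ {n} → VSet n → ESet n → ℕ → Set
IsBW {n} V E b =
  (Σ (VSet n) λ A → IsBisection V A × countE (crossing E A) ≡ b) ×
  (∀ A → IsBisection V A → b ≤ countE (crossing E A))

IsHB : ∀ {n} → Graph n → ℕ → Set
IsHB G h =
  (Σ (SubGraph G) λ H → IsBW (V H) (E H) h) ×
  (∀ (H : SubGraph G) b → IsBW (V H) (E H) b → b ≤ h)

-- Out G p q X T : T is a possible output of CongSpanTree(G[X]) when every
-- call of the cut subroutine on an input H returns a 2/3-balanced cut with at
-- most α · b(H) crossing edges, where α = p / q.
data Out {n : ℕ} (G : Graph n) (p q : ℕ) : VSet n → ESet n → Set where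
  single : ∀ {X T} → size X ≡ 1 → (∀ i j → T i j ≡ false) → Out G p q X T
  split  : ∀ {X T} → 2 ≤ size X →
           (S : VSet n) → S ⊆ X →
           3 * size S ≤ 2 * size X →
           3 * size (X ∖ S) ≤ 2 * size X →
           (∀ b → IsBW X (induced G X) b →
              q * countE (crossing (induced G X) S) ≤ p * b) →
           (∀ C → IsComponent X (λ i j → induced G X i j ∧ not (S i xor S j)) C →
              Out G p q C (restrict T C)) →
           IsSpanningTree X (induced G X) T →
           Out G p q X T

{-# OPTIONS --safe #-}
module Submission where

-- Fix the tree edge uv, let Su be the side of u in T − uv and D the set of edges of G leaving Su.
-- Follow the recursion of CongSpanTree. At a call on X with cut F, an edge xy ∈ D inside X either
-- lies in F, and there are at most α·b(G[X]) ≤ α·hb(G) of those, or it lies in a component C of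
-- X − F. In the latter case the subtree built for C joins x and y inside C; a path of T avoiding u
-- avoids uv and so cannot leave Su, hence C contains u. So every edge of D is charged to a call on
-- the single chain of nested components containing u. Each of these has at most 2/3 of the size of
-- its parent, and (3/2)² ≥ 2, so the chain has at most 2⌈log₂ n⌉ calls: the constant is 2.

open import Defs
open import Data.Nat.Logarithm using (⌈log₂_⌉)
open import Data.Nat.Logarithm.Core using (⌈log2⌉)
open import Data.Fin using (Fin; zero; suc; toℕ; _≟_)
open import Data.Fin.Properties using (any?; all?)
open import Data.Fin.Subset.Properties using (anySubset?)
open import Data.Vec using (lookup; tabulate)
open import Data.Vec.Properties using (lookup∘tabulate)
open import Data.Bool using (Bool; true; false; _∧_; _∨_; _xor_; not; if_then_else_)
open import Data.Bool.Properties
  using (∧-conicalˡ; ∧-conicalʳ; ∧-zeroʳ; ∨-zeroʳ; xor-same; xor-comm; not-involutive)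
  renaming (_≟_ to _≟ᵇ_)
open import Data.List using (map; allFin)
open import Data.List.Properties using (map-tabulate)
open import Data.Nat using (ℕ; zero; suc; _+_; _*_; _^_; _≤_; _<_; _<ᵇ_; z≤n; s≤s; ⌈_/2⌉; ⌊_/2⌋; _≤?_; _<?_)
open import Data.Nat.Properties hiding (_≟_)
open import Data.Nat.ListAction using (sum)
open import Data.Nat.Induction using (<-wellFounded)
open import Data.Nat.Tactic.RingSolver using (solve-∀)
open import Data.Product using (Σ; ∃; _×_; _,_; proj₁; proj₂)
open import Data.Sum using (_⊎_; inj₁; inj₂)
open import Function using (_∘_; id)
open import Function.Bundles using (_⇔_; mk⇔; Equivalence)
open import Induction.WellFounded using (Acc; acc)
open import Relation.Nullary using (Dec; yes; no; contradiction)
open import Relation.Nullary.Decidable using (⌊_⌋; isYes≗does; dec-true; dec-false; _×-dec_; _→-dec_)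
open import Algebra.Properties.CommutativeSemigroup +-commutativeSemigroup
  using () renaming (interchange to +-interchange)
open import Algebra.Properties.CommutativeSemigroup *-commutativeSemigroup
  using () renaming (x∙yz≈y∙xz to *-swap)
open import Relation.Binary.PropositionalEquality as ≡
  using (_≡_; _≢_; _≗_; refl; trans; cong; cong₂; subst; subst₂)

𝟙 : Bool → ℕ
𝟙 b = if b then 1 else 0

∑ : ∀ {m} → (Fin m → ℕ) → ℕ
∑ f = sum (map f (allFin _))

∑-suc : ∀ {m} (f : Fin (suc m) → ℕ) → ∑ f ≡ f zero + ∑ (f ∘ suc)
∑-suc f = cong (λ xs → f zero + sum xs) (trans (map-tabulate suc f) (≡.sym (map-tabulate id (f ∘ suc))))

∑-cong : ∀ {m} {f g : Fin m → ℕ} → f ≗ g → ∑ f ≡ ∑ g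
∑-cong {zero}  _   = refl
∑-cong {suc m} {f} {g} f≗g rewrite ∑-suc f | ∑-suc g = cong₂ _+_ (f≗g zero) (∑-cong (f≗g ∘ suc))

∑-mono : ∀ {m} {f g : Fin m → ℕ} → (∀ i → f i ≤ g i) → ∑ f ≤ ∑ g
∑-mono {zero}  _   = z≤n
∑-mono {suc m} {f} {g} f≤g rewrite ∑-suc f | ∑-suc g = +-mono-≤ (f≤g zero) (∑-mono (f≤g ∘ suc))

∑-< : ∀ {m} {f g : Fin m → ℕ} → (∀ i → f i ≤ g i) → ∀ i → f i < g i → ∑ f < ∑ g
∑-< {suc m} {f} {g} f≤g zero    f<g rewrite ∑-suc f | ∑-suc g = +-mono-<-≤ f<g (∑-mono (f≤g ∘ suc))
∑-< {suc m} {f} {g} f≤g (suc i) f<g rewrite ∑-suc f | ∑-suc g =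
  +-mono-≤-< (f≤g zero) (∑-< (f≤g ∘ suc) i f<g)

∑-+ : ∀ {m} (f g : Fin m → ℕ) → ∑ (λ i → f i + g i) ≡ ∑ f + ∑ g
∑-+ {zero}  _ _ = refl
∑-+ {suc m} f g rewrite ∑-suc (λ i → f i + g i) | ∑-suc f | ∑-suc g | ∑-+ (f ∘ suc) (g ∘ suc) =
  +-interchange (f zero) (g zero) (∑ (f ∘ suc)) (∑ (g ∘ suc))

∑-zero : ∀ {m} {f : Fin m → ℕ} → (∀ i → f i ≡ 0) → ∑ f ≡ 0
∑-zero {zero}  _    = refl
∑-zero {suc m} {f} f≡0 rewrite ∑-suc f | f≡0 zero = ∑-zero (f≡0 ∘ suc)

term≤∑ : ∀ {m} (f : Fin m → ℕ) i → f i ≤ ∑ f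
term≤∑ f zero    rewrite ∑-suc f = m≤m+n _ _
term≤∑ f (suc i) rewrite ∑-suc f = ≤-trans (term≤∑ (f ∘ suc) i) (m≤n+m _ _)

∑-≤-card : ∀ {m} {f : Fin m → ℕ} → (∀ i → f i ≤ 1) → ∑ f ≤ m
∑-≤-card {zero}  _    = z≤n
∑-≤-card {suc m} {f} f≤1 rewrite ∑-suc f = +-mono-≤ (f≤1 zero) (∑-≤-card (f≤1 ∘ suc))

𝟙-mono : ∀ {a b} → (a ≡ true → b ≡ true) → 𝟙 a ≤ 𝟙 b
𝟙-mono {false} _   = z≤n
𝟙-mono {true}  a⇒b rewrite a⇒b refl = ≤-refl

𝟙-≤1 : ∀ b → 𝟙 b ≤ 1
𝟙-≤1 false = z≤n
𝟙-≤1 true  = ≤-refl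

∧-monoʳ-true : ∀ {a b} c → (a ≡ true → b ≡ true) → c ∧ a ≡ true → c ∧ b ≡ true
∧-monoʳ-true true a⇒b = a⇒b

not≡true⇒≡false : ∀ {b} → not b ≡ true → b ≡ false
not≡true⇒≡false {b} not-b = trans (≡.sym (not-involutive b)) (cong not not-b)

eqF-refl : ∀ {m} (i : Fin m) → eqF i i ≡ true
eqF-refl i = trans (isYes≗does (i ≟ i)) (dec-true (i ≟ i) refl)

eqF-≢ : ∀ {m} {i j : Fin m} → i ≢ j → eqF i j ≡ false
eqF-≢ {i = i} {j} i≢j = trans (isYes≗does (i ≟ j)) (dec-false (i ≟ j) i≢j)

eqF⇒≡ : ∀ {m} {i j : Fin m} → eqF i j ≡ true → i ≡ j
eqF⇒≡ {i = i} {j} _ with i ≟ j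
... | yes i≡j = i≡j

size-suc : ∀ {m} (X : VSet (suc m)) → size X ≡ 𝟙 (X zero) + size (X ∘ suc)
size-suc X = ∑-suc (𝟙 ∘ X)

size-≤ : ∀ {m} (X : VSet m) → size X ≤ m
size-≤ X = ∑-≤-card (𝟙-≤1 ∘ X)

size-mono : ∀ {m} {X Y : VSet m} → X ⊆ Y → size X ≤ size Y
size-mono X⊆Y = ∑-mono (λ i → 𝟙-mono (X⊆Y i))

size-cong : ∀ {m} {X Y : VSet m} → X ≗ Y → size X ≡ size Y
size-cong X≗Y = ∑-cong (cong 𝟙 ∘ X≗Y)

size-pos : ∀ {m} {X : VSet m} {i} → X i ≡ true → 0 < size X
size-pos {X = X} {i} Xi = ≤-trans (≤-reflexive (cong 𝟙 (≡.sym Xi))) (term≤∑ (𝟙 ∘ X) i)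

size-< : ∀ {m} {X Y : VSet m} {w} → X ⊆ Y → X w ≡ false → Y w ≡ true → size X < size Y
size-< X⊆Y Xw Yw =
  ∑-< (λ i → 𝟙-mono (X⊆Y i)) _ (subst₂ (λ a b → 𝟙 a < 𝟙 b) (≡.sym Xw) (≡.sym Yw) ≤-refl)

size≡1⇒unique : ∀ {m} (X : VSet m) {i j} → size X ≡ 1 → X i ≡ true → X j ≡ true → i ≡ j
size≡1⇒unique X {i} {j} size≡1 Xi Xj with i ≟ j
... | yes i≡j = i≡j
... | no  i≢j = contradiction (subst (1 <_) size≡1 1<size) (<-irrefl refl)
  where
  singleton<X : size (eqF i) < size X
  singleton<X = size-< {w = j} (λ k i≡k → subst (λ k → X k ≡ true) (eqF⇒≡ i≡k) Xi) (eqF-≢ i≢j) Xj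
  1<size : 1 < size X
  1<size = ≤-trans (s≤s (size-pos {X = eqF i} (eqF-refl i))) singleton<X

_⊆ᴱ_ : ∀ {m} → ESet m → ESet m → Set
E ⊆ᴱ F = ∀ i j → E i j ≡ true → F i j ≡ true

_∪ᴱ_ : ∀ {m} → ESet m → ESet m → ESet m
(E ∪ᴱ F) i j = E i j ∨ F i j

restrict-⊆ : ∀ {m} (E : ESet m) (C : VSet m) → restrict E C ⊆ᴱ E
restrict-⊆ E C i j in-C = ∧-conicalʳ (C j) _ (∧-conicalʳ (C i) _ in-C)

restrict-mono : ∀ {m} {E F : ESet m} (C : VSet m) → E ⊆ᴱ F → restrict E C ⊆ᴱ restrict F C
restrict-mono C E⊆F i j = ∧-monoʳ-true (C i) (∧-monoʳ-true (C j) (E⊆F i j))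

crossing-⊆ : ∀ {m} (E : ESet m) (S : VSet m) → crossing E S ⊆ᴱ E
crossing-⊆ E S i j = ∧-conicalˡ _ _

countE-cong : ∀ {m} {E F : ESet m} → (∀ i j → E i j ≡ F i j) → countE E ≡ countE F
countE-cong E≗F = ∑-cong λ i → ∑-cong λ j → cong (λ b → 𝟙 (_ ∧ b)) (E≗F i j)

countE-mono : ∀ {m} {E F : ESet m} → E ⊆ᴱ F → countE E ≤ countE F
countE-mono E⊆F = ∑-mono λ i → ∑-mono λ j → 𝟙-mono (∧-monoʳ-true _ (E⊆F i j))

countE-∪ : ∀ {m} (E F : ESet m) → countE (E ∪ᴱ F) ≤ countE E + countE F
countE-∪ E F = ≤-trans (∑-mono λ i → ≤-trans (∑-mono λ j → 𝟙-∧-∨ _ (E i j) (F i j))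
                                             (≤-reflexive (∑-+ (pair E i) (pair F i))))
                       (≤-reflexive (∑-+ (∑ ∘ pair E) (∑ ∘ pair F)))
  where
  pair : ESet _ → Fin _ → Fin _ → ℕ
  pair E i j = 𝟙 ((toℕ i <ᵇ toℕ j) ∧ E i j)
  𝟙-∧-∨ : ∀ c a b → 𝟙 (c ∧ (a ∨ b)) ≤ 𝟙 (c ∧ a) + 𝟙 (c ∧ b)
  𝟙-∧-∨ false _     _ = z≤n
  𝟙-∧-∨ true  true  _ = s≤s z≤n
  𝟙-∧-∨ true  false b = ≤-refl

countE-loops : ∀ {m} {E : ESet m} → (∀ i j → E i j ≡ true → i ≡ j) → countE E ≡ 0
countE-loops {E = E} loops = ∑-zero λ i → ∑-zero λ j → no-pair i j
  where
  n<ᵇn : ∀ n → (n <ᵇ n) ≡ false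
  n<ᵇn zero    = refl
  n<ᵇn (suc n) = n<ᵇn n
  no-pair : ∀ i j → 𝟙 ((toℕ i <ᵇ toℕ j) ∧ E i j) ≡ 0
  no-pair i j with E i j in Eij
  ... | false = cong 𝟙 (∧-zeroʳ _)
  ... | true with loops i j Eij
  ...   | refl rewrite n<ᵇn (toℕ i) = refl

-- Paths and connected components

infixr 5 _◅◅_

_◅◅_ : ∀ {m} {E : ESet m} {a b c} → Path E a b → Path E b c → Path E a c
here       ◅◅ q = q
step e p   ◅◅ q = step e (p ◅◅ q)

reversePath : ∀ {m} {E : ESet m} → (∀ i j → E i j ≡ E j i) → ∀ {a b} → Path E a b → Path E b a
reversePath E-sym here                 = here
reversePath E-sym (step {i} {j} e p) = reversePath E-sym p ◅◅ step (trans (E-sym j i) e) here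

mapPath : ∀ {m} {E F : ESet m} → E ⊆ᴱ F → ∀ {a b} → Path E a b → Path F a b
mapPath E⊆F here       = here
mapPath E⊆F (step e p) = step (E⊆F _ _ e) (mapPath E⊆F p)

path-invariant : ∀ {m} {E : ESet m} (P : Fin m → Set) → (∀ {i j} → E i j ≡ true → P i → P j) →
                 ∀ {a b} → Path E a b → P a → P b
path-invariant P preserve here       Pa = Pa
path-invariant P preserve (step e p) Pa = path-invariant P preserve p (preserve e Pa)

module Reachability {m} (E : ESet m) (a : Fin m) where

  layer : ℕ → VSet m
  layer zero    w = eqF a w
  layer (suc t) w = layer t w ∨ ⌊ any? (λ z → layer t z ∧ E z w ≟ᵇ true) ⌋

  layer-⊆ : ∀ t → layer t ⊆ layer (suc t)
  layer-⊆ t w in-t rewrite in-t = refl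

  layer-step : ∀ t {z w} → layer t z ≡ true → E z w ≡ true → layer (suc t) w ≡ true
  layer-step t {z} {w} in-t e =
    trans (cong (layer t w ∨_) (trans (isYes≗does (any? _)) (dec-true (any? _) (z , cong₂ _∧_ in-t e))))
          (∨-zeroʳ (layer t w))

  layer-unstep : ∀ t {w} → layer (suc t) w ≡ true → layer t w ≡ true ⊎ ∃ λ z → layer t z ∧ E z w ≡ true
  layer-unstep t {w} in-t+1 with layer t w | any? (λ z → layer t z ∧ E z w ≟ᵇ true)
  ... | true  | _         = inj₁ refl
  ... | false | yes found = inj₂ found

  layer-start : ∀ t → layer t a ≡ true
  layer-start zero    = eqF-refl a
  layer-start (suc t) = layer-⊆ t a (layer-start t)

  layer-sound : ∀ t {w} → layer t w ≡ true → Path E a w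
  layer-sound zero    in-0 with eqF⇒≡ in-0
  ... | refl = here
  layer-sound (suc t) in-t+1 with layer-unstep t in-t+1
  ... | inj₁ in-t       = layer-sound t in-t
  ... | inj₂ (z , in-e) = layer-sound t (∧-conicalˡ _ _ in-e) ◅◅ step (∧-conicalʳ _ _ in-e) here

  Closed : ℕ → Set
  Closed t = ∀ {z w} → layer t z ≡ true → E z w ≡ true → layer t w ≡ true

  closed-suc : ∀ t → Closed t → Closed (suc t)
  closed-suc t closed-t in-t+1 e = layer-⊆ t _ (closed-t (shrink in-t+1) e)
    where
    shrink : ∀ {y} → layer (suc t) y ≡ true → layer t y ≡ true
    shrink in-t+1 with layer-unstep t in-t+1
    ... | inj₁ in-t       = in-t
    ... | inj₂ (z , in-e) = closed-t (∧-conicalˡ _ _ in-e) (∧-conicalʳ _ _ in-e)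

  closed-or-grows : ∀ t → Closed t ⊎ size (layer t) < size (layer (suc t))
  closed-or-grows t with any? (λ w → not (layer t w) ∧ layer (suc t) w ≟ᵇ true)
  ... | yes (w , new)   =
    inj₂ (size-< {w = w} (layer-⊆ t) (not≡true⇒≡false (∧-conicalˡ _ _ new)) (∧-conicalʳ _ _ new))
  ... | no  nothing-new = inj₁ closed-t
    where
    closed-t : Closed t
    closed-t {z} {w} in-t e with layer t w in out
    ... | true  = refl
    ... | false =
      contradiction (w , trans (cong (λ b → not b ∧ layer (suc t) w) out) (layer-step t in-t e)) nothing-new

  closed-or-large : ∀ t → Closed t ⊎ t < size (layer t)
  closed-or-large zero = inj₂ (size-pos {X = layer zero} (eqF-refl a))
  closed-or-large (suc t) with closed-or-large t | closed-or-grows t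
  ... | inj₁ closed-t | _             = inj₁ (closed-suc t closed-t)
  ... | inj₂ _        | inj₁ closed-t = inj₁ (closed-suc t closed-t)
  ... | inj₂ large    | inj₂ grows    = inj₂ (≤-trans (s≤s large) grows)

  -- The layers grow strictly until they are closed, and they have at most m elements.
  closed : Closed m
  closed with closed-or-large m
  ... | inj₁ closed-m = closed-m
  ... | inj₂ large    = contradiction (size-≤ (layer m)) (<⇒≱ large)

  closed-path : ∀ {z w} → layer m z ≡ true → Path E z w → layer m w ≡ true
  closed-path in-m here       = in-m
  closed-path in-m (step e p) = closed-path (closed in-m e) p

reachable : ∀ {m} → ESet m → Fin m → VSet m
reachable {m} E a = Reachability.layer E a m

reachable-sound : ∀ {m} {E : ESet m} {a w} → reachable E a w ≡ true → Path E a w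
reachable-sound {m} {E} {a} = Reachability.layer-sound E a m

reachable-complete : ∀ {m} {E : ESet m} {a w} → Path E a w → reachable E a w ≡ true
reachable-complete {m} {E} {a} = Reachability.closed-path E a (Reachability.layer-start E a m)

reachable-isComponent : ∀ {m} {X : VSet m} (E : ESet m) {a} → X a ≡ true → IsComponent X E (reachable E a)
reachable-isComponent E {a} Xa = a , Xa , λ w → mk⇔ reachable-sound reachable-complete

-- Existence of the bisection width

alternate : ∀ {m} → VSet m → Bool → VSet m
alternate X b zero    = X zero ∧ b
alternate X b (suc i) = alternate (X ∘ suc) (if X zero then not b else b) i

alternate-⊆ : ∀ {m} (X : VSet m) b → alternate X b ⊆ X
alternate-⊆ X b zero    in-A = ∧-conicalˡ _ _ in-A
alternate-⊆ X b (suc i) in-A = alternate-⊆ (X ∘ suc) _ i in-A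

alternate-complement : ∀ {m} (X : VSet m) b → (X ∖ alternate X b) ≗ alternate X (not b)
alternate-complement X b zero with X zero
... | true  = refl
... | false = refl
alternate-complement X b (suc i) with X zero
... | true  = alternate-complement (X ∘ suc) (not b) i
... | false = alternate-complement (X ∘ suc) b i

alternate-size : ∀ {m} (X : VSet m) →
                 size (alternate X true) ≡ ⌈ size X /2⌉ × size (alternate X false) ≡ ⌊ size X /2⌋
alternate-size {zero}  X = refl , refl
alternate-size {suc m} X
  rewrite size-suc X | size-suc (alternate X true) | size-suc (alternate X false)
  with X zero | alternate-size (X ∘ suc)
... | true  | size-true , size-false = cong suc size-false , size-true
... | false | size-true , size-false = size-true , size-false

alternate-isBisection : ∀ {m} (X : VSet m) → IsBisection X (alternate X true)
alternate-isBisection X =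
    alternate-⊆ X true
  , ≤-reflexive (proj₁ (alternate-size X))
  , ≤-trans (≤-reflexive (trans (size-cong (alternate-complement X true)) (proj₂ (alternate-size X))))
            (⌊n/2⌋≤⌈n/2⌉ (size X))

isBisection? : ∀ {m} (X A : VSet m) → Dec (IsBisection X A)
isBisection? X A =
  all? (λ i → (A i ≟ᵇ true) →-dec (X i ≟ᵇ true)) ×-dec
  (size A ≤? ⌈ size X /2⌉) ×-dec (size (X ∖ A) ≤? ⌈ size X /2⌉)

isBisection-cong : ∀ {m} (X : VSet m) {A B} → A ≗ B → IsBisection X A → IsBisection X B
isBisection-cong X A≗B (A⊆X , small-A , small-X∖A) =
    (λ i in-B → A⊆X i (trans (A≗B i) in-B))
  , subst (_≤ _) (size-cong A≗B) small-A
  , subst (_≤ _) (size-cong (λ i → cong (λ b → X i ∧ not b) (A≗B i))) small-X∖A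

minimise : ∀ {m} (P : VSet m → Set) → (∀ A → Dec (P A)) → (∀ {A B} → A ≗ B → P A → P B) →
           (cost : VSet m → ℕ) → (∀ {A B} → A ≗ B → cost A ≡ cost B) →
           ∀ A → P A → Σ (VSet m) λ M → P M × (∀ B → P B → cost M ≤ cost B)
minimise P P? P-cong cost cost-cong A = descend A (<-wellFounded (cost A))
  where
  descend : ∀ A → Acc _<_ (cost A) → P A → Σ (VSet _) λ M → P M × (∀ B → P B → cost M ≤ cost B)
  descend A (acc smaller) PA with anySubset? (λ s → P? (lookup s) ×-dec (cost (lookup s) <? cost A))
  ... | yes (s , Ps , cheaper) = descend (lookup s) (smaller cheaper) Ps
  ... | no  none = A , PA , λ B PB → ≮⇒≥ λ cheaper →
          none (tabulate B , P-cong B≗ PB , subst (_< cost A) (cost-cong B≗) cheaper)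
    where
    B≗ : ∀ {B} → B ≗ lookup (tabulate B)
    B≗ {B} i = ≡.sym (lookup∘tabulate B i)

countE-crossing-cong : ∀ {m} (E : ESet m) {A B : VSet m} → A ≗ B →
                       countE (crossing E A) ≡ countE (crossing E B)
countE-crossing-cong E A≗B = countE-cong λ i j → cong₂ (λ a b → E i j ∧ (a xor b)) (A≗B i) (A≗B j)

bisectionWidth : ∀ {m} (X : VSet m) (E : ESet m) → Σ ℕ (IsBW X E)
bisectionWidth X E
  with minimise (IsBisection X) (isBisection? X) (isBisection-cong X) (countE ∘ crossing E)
                (countE-crossing-cong E) (alternate X true) (alternate-isBisection X)
... | A , bisection , minimal = countE (crossing E A) , (A , bisection , refl) , minimal

-- Depth of the recursion

n≤2*⌈n/2⌉ : ∀ n → n ≤ 2 * ⌈ n /2⌉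
n≤2*⌈n/2⌉ n = begin
  n                     ≡⟨ ⌊n/2⌋+⌈n/2⌉≡n n ⟨
  ⌊ n /2⌋ + ⌈ n /2⌉     ≤⟨ +-monoˡ-≤ ⌈ n /2⌉ (⌊n/2⌋≤⌈n/2⌉ n) ⟩
  ⌈ n /2⌉ + ⌈ n /2⌉     ≡⟨ cong (⌈ n /2⌉ +_) (+-identityʳ ⌈ n /2⌉) ⟨
  2 * ⌈ n /2⌉           ∎
  where open ≤-Reasoning

n≤2^⌈log₂n⌉ : ∀ n → n ≤ 2 ^ ⌈log₂ n ⌉
n≤2^⌈log₂n⌉ n = bound n (<-wellFounded n)
  where
  bound : ∀ n (rec : Acc _<_ n) → n ≤ 2 ^ ⌈log2⌉ n rec
  bound 0               _           = z≤n
  bound 1               _           = ≤-refl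
  bound (suc (suc n)) (acc smaller) =
    ≤-trans (n≤2*⌈n/2⌉ (2 + n)) (*-monoʳ-≤ 2 (bound (suc ⌈ n /2⌉) (smaller (⌈n/2⌉<n n))))

4^n*2^n≤9^n : ∀ n → 4 ^ n * 2 ^ n ≤ 9 ^ n
4^n*2^n≤9^n zero    = ≤-refl
4^n*2^n≤9^n (suc n) = begin
  4 * 4 ^ n * (2 * 2 ^ n)   ≡⟨ regroup (4 ^ n) (2 ^ n) ⟩
  8 * (4 ^ n * 2 ^ n)       ≤⟨ *-mono-≤ (n≤1+n 8) (4^n*2^n≤9^n n) ⟩
  9 * 9 ^ n                 ∎
  where
  open ≤-Reasoning
  regroup : ∀ a b → 4 * a * (2 * b) ≡ 8 * (a * b)
  regroup = solve-∀

depth-bound : ∀ n → 2 ^ (2 * ⌈log₂ n ⌉) * n ≤ 3 ^ (2 * ⌈log₂ n ⌉)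
depth-bound n = begin
  2 ^ (2 * l) * n      ≤⟨ *-monoʳ-≤ (2 ^ (2 * l)) (n≤2^⌈log₂n⌉ n) ⟩
  2 ^ (2 * l) * 2 ^ l  ≡⟨ cong (_* 2 ^ l) (^-*-assoc 2 2 l) ⟨
  4 ^ l * 2 ^ l        ≤⟨ 4^n*2^n≤9^n l ⟩
  9 ^ l                ≡⟨ ^-*-assoc 3 2 l ⟩
  3 ^ (2 * l)          ∎
  where
  open ≤-Reasoning
  l = ⌈log₂ n ⌉

depth-shrink : ∀ k {c x} → 3 * c ≤ 2 * x → 2 ^ suc k * x ≤ 3 ^ suc k → 2 ^ k * c ≤ 3 ^ k
depth-shrink k {c} {x} 3c≤2x depth = *-cancelˡ-≤ 3 (begin
  3 * (2 ^ k * c)      ≡⟨ *-swap 3 (2 ^ k) c ⟩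
  2 ^ k * (3 * c)      ≤⟨ *-monoʳ-≤ (2 ^ k) 3c≤2x ⟩
  2 ^ k * (2 * x)      ≡⟨ *-swap (2 ^ k) 2 x ⟩
  2 * (2 ^ k * x)      ≡⟨ *-assoc 2 (2 ^ k) x ⟨
  2 ^ suc k * x        ≤⟨ depth ⟩
  3 ^ suc k            ∎)
  where open ≤-Reasoning

induced-sym : ∀ {n} (G : Graph n) (X : VSet n) i j → induced G X i j ≡ induced G X j i
induced-sym G X i j with X i | X j
... | true  | true  = sym G i j
... | true  | false = refl
... | false | true  = refl
... | false | false = refl

inducedSubGraph : ∀ {n} (G : Graph n) → VSet n → SubGraph G
inducedSubGraph G X = record
  { V     = X
  ; E     = induced G X
  ; E-sym = induced-sym G X
  ; E-sub = λ i j in-X → let Xj∧adj = ∧-conicalʳ (X i) _ in-X in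
      ∧-conicalʳ (X j) _ Xj∧adj , ∧-conicalˡ _ _ in-X , ∧-conicalˡ _ _ Xj∧adj
  }

bisectionWidth-≤-hb : ∀ {n} {G : Graph n} {h} → IsHB G h → ∀ X → Σ ℕ λ b → IsBW X (induced G X) b × b ≤ h
bisectionWidth-≤-hb {G = G} hb X with bisectionWidth X (induced G X)
... | b , isBW = b , isBW , proj₂ hb (inducedSubGraph G X) b isBW

out-connected : ∀ {n} {G : Graph n} {p q X T} → Out G p q X T → Connected X T
out-connected {X = X} (single size≡1 _) i j Xi Xj with size≡1⇒unique X size≡1 Xi Xj
... | refl = here
out-connected (split _ _ _ _ _ _ _ (_ , _ , connected , _)) = connected

uncut : ∀ {n} → Graph n → VSet n → VSet n → ESet n
uncut G X S i j = induced G X i j ∧ not (S i xor S j)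

uncut-sym : ∀ {n} (G : Graph n) X S i j → uncut G X S i j ≡ uncut G X S j i
uncut-sym G X S i j = cong₂ (λ e c → e ∧ not c) (induced-sym G X i j) (xor-comm (S i) (S j))

uncut-or-cut : ∀ {n} {G : Graph n} {X S i j} → induced G X i j ≡ true →
               crossing (induced G X) S i j ≡ false → uncut G X S i j ≡ true
uncut-or-cut e≡true crossing≡false rewrite e≡true = cong not crossing≡false

uncut-side : ∀ {n} {G : Graph n} {X S a w} → Path (uncut G X S) a w → X a ≡ true → X w ≡ true × S w ≡ S a
uncut-side {G = G} {X} {S} {a} p Xa = path-invariant (λ w → X w ≡ true × S w ≡ S a) preserve p (Xa , refl)
  where
  same-side : ∀ x y → not (x xor y) ≡ true → y ≡ x
  same-side true  true  _ = refl
  same-side false false _ = refl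
  preserve : ∀ {i j} → uncut G X S i j ≡ true → X i ≡ true × S i ≡ S a → X j ≡ true × S j ≡ S a
  preserve {i} {j} e (_ , Si) =
    ∧-conicalˡ _ _ (∧-conicalʳ (X i) _ (∧-conicalˡ _ _ e)) , trans (same-side (S i) (S j) (∧-conicalʳ _ _ e)) Si

component-small : ∀ {n} {G : Graph n} {X S a} → X a ≡ true →
                  3 * size S ≤ 2 * size X → 3 * size (X ∖ S) ≤ 2 * size X →
                  3 * size (reachable (uncut G X S) a) ≤ 2 * size X
component-small {G = G} {X} {S} {a} Xa small-S small-X∖S with S a in Sa
... | true  = ≤-trans (*-monoʳ-≤ 3 (size-mono inside)) small-S
  where
  inside : reachable (uncut G X S) a ⊆ S
  inside w r = trans (proj₂ (uncut-side {G = G} {X} {S} (reachable-sound r) Xa)) Sa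
... | false = ≤-trans (*-monoʳ-≤ 3 (size-mono outside)) small-X∖S
  where
  outside : reachable (uncut G X S) a ⊆ (X ∖ S)
  outside w r with uncut-side {G = G} {X} {S} (reachable-sound r) Xa
  ... | Xw , Sw rewrite Xw | Sw | Sa = refl

-- Crossing edges of a tree edge

Separates : ∀ {n} → Fin n → ESet n → ESet n → Set
Separates {n} u T D = ∀ (C : VSet n) → C u ≡ false → Connected C (restrict T C) →
                      ∀ {x y} → C x ≡ true → C y ≡ true → D x y ≡ false

side-separates : ∀ {n} {E T : ESet n} {u v : Fin n} {Su : VSet n} →
                 (∀ w → (Su w ≡ true) ⇔ Path (removeEdge T u v) u w) → Separates u T (crossing E Su)
side-separates {E = E} {T} {u} {v} {Su} side C Cu connected {x} {y} Cx Cy =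
  begin
    E x y ∧ (Su x xor Su y)  ≡⟨ cong (λ s → E x y ∧ (s xor Su y)) same-side ⟩
    E x y ∧ (Su y xor Su y)  ≡⟨ cong (E x y ∧_) (xor-same (Su y)) ⟩
    E x y ∧ false            ≡⟨ ∧-zeroʳ (E x y) ⟩
    false                    ∎
  where
  open ≡.≡-Reasoning
  off-u : ∀ {i} → C i ≡ true → eqF i u ≡ false
  off-u Ci = eqF-≢ λ { refl → contradiction (trans (≡.sym Ci) Cu) λ () }
  keeps : ∀ {t a b c d} → t ≡ true → a ≡ false → d ≡ false → t ∧ not ((a ∧ b) ∨ (c ∧ d)) ≡ true
  keeps {c = c} refl refl refl rewrite ∧-zeroʳ c = refl
  avoids-uv : restrict T C ⊆ᴱ removeEdge T u v
  avoids-uv i j in-C =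
    keeps (restrict-⊆ T C i j in-C) (off-u (∧-conicalˡ _ _ in-C))
          (off-u (∧-conicalˡ _ _ (∧-conicalʳ (C i) _ in-C)))
  along : ∀ {a b} → C a ≡ true → C b ≡ true → Path (removeEdge T u v) a b
  along Ca Cb = mapPath avoids-uv (connected _ _ Ca Cb)
  stays : ∀ {a b} → C a ≡ true → C b ≡ true → Su a ≡ true → Su b ≡ true
  stays Ca Cb Sa = Equivalence.from (side _) (Equivalence.to (side _) Sa ◅◅ along Ca Cb)
  same-side : Su x ≡ Su y
  same-side with Su x in Sx | Su y in Sy
  ... | true  | true  = refl
  ... | false | false = refl
  ... | true  | false = contradiction (trans (≡.sym (stays Cx Cy Sx)) Sy) λ ()
  ... | false | true  = contradiction (trans (≡.sym (stays Cy Cx Sy)) Sx) λ ()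

module CrossingBound {n} {G : Graph n} {p q h : ℕ} (hb : IsHB G h) {T : ESet n} {u : Fin n} {D : ESet n}
                     (D⊆G : D ⊆ᴱ adj G) (separated : Separates u T D) where

  open ≤-Reasoning

  cut-bound : ∀ {X S} → (∀ b → IsBW X (induced G X) b → q * countE (crossing (induced G X) S) ≤ p * b) →
              q * countE (crossing (induced G X) S) ≤ p * h
  cut-bound {X} cut with bisectionWidth-≤-hb hb X
  ... | b , isBW , b≤h = ≤-trans (cut b isBW) (*-monoʳ-≤ p b≤h)

  uncut-edge-in-u-component : ∀ {X S TX} →
    (∀ C → IsComponent X (uncut G X S) C → Out G p q C (restrict TX C)) → TX ⊆ᴱ T →
    ∀ {x y} → restrict D X x y ≡ true → crossing (induced G X) S x y ≡ false →
    X u ≡ true × restrict D (reachable (uncut G X S) u) x y ≡ true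
  uncut-edge-in-u-component {X} {S} {TX} rec TX⊆T {x} {y} in-X uncrossed =
    proj₁ (uncut-side {G = G} {X} {S} x→u Xx) ,
    cong₂ _∧_ (reachable-complete u→x) (cong₂ _∧_ (reachable-complete (u→x ◅◅ step xy-uncut here)) Dxy)
    where
    Xx = ∧-conicalˡ _ _ in-X
    Xy = ∧-conicalˡ _ _ (∧-conicalʳ (X x) _ in-X)
    Dxy = ∧-conicalʳ (X y) _ (∧-conicalʳ (X x) _ in-X)
    E′ = uncut G X S
    Cx = reachable E′ x
    xy-uncut : E′ x y ≡ true
    xy-uncut = uncut-or-cut {G = G} {X} {S} (cong₂ _∧_ Xx (cong₂ _∧_ Xy (D⊆G x y Dxy))) uncrossed
    Cx-connected : Connected Cx (restrict T Cx)
    Cx-connected i j Ci Cj =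
      mapPath (restrict-mono Cx TX⊆T) (out-connected (rec Cx (reachable-isComponent E′ Xx)) i j Ci Cj)
    u∈Cx : Cx u ≡ true
    u∈Cx with Cx u in Cx-u
    ... | true  = refl
    ... | false = contradiction (trans (≡.sym D≡false) Dxy) λ ()
      where
      D≡false = separated Cx Cx-u Cx-connected (reachable-complete {E = E′} here)
                          (reachable-complete {E = E′} (step xy-uncut here))
    x→u : Path E′ x u
    x→u = reachable-sound u∈Cx
    u→x : Path E′ u x
    u→x = reversePath (uncut-sym G X S) x→u

  crossing-bound : ∀ k {X TX} → Out G p q X TX → TX ⊆ᴱ T → 2 ^ k * size X ≤ 3 ^ k →
                   q * countE (restrict D X) ≤ k * (p * h)
  crossing-bound k {X} (single size≡1 _) _ _ = begin
    q * countE (restrict D X)  ≡⟨ cong (q *_) (countE-loops loop) ⟩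
    q * 0                      ≡⟨ *-zeroʳ q ⟩
    0                          ≤⟨ z≤n ⟩
    k * (p * h)                ∎
    where
    loop : ∀ i j → restrict D X i j ≡ true → i ≡ j
    loop i j in-X = size≡1⇒unique X size≡1 (∧-conicalˡ _ _ in-X) (∧-conicalˡ _ _ (∧-conicalʳ (X i) _ in-X))
  crossing-bound zero (split 2≤size _ _ _ _ _ _ _) _ depth =
    contradiction (≤-trans 2≤size (≤-trans (≤-reflexive (≡.sym (*-identityˡ _))) depth)) λ { (s≤s ()) }
  crossing-bound (suc k) {X} {TX} (split _ S _ small-S small-X∖S cut rec _) TX⊆T depth = by-position-of-u
    where
    F = crossing (induced G X) S
    Cu = reachable (uncut G X S) u
    F-bound : q * countE F ≤ p * h
    F-bound = cut-bound {X} {S} cut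
    cut-or-Cu : restrict D X ⊆ᴱ (F ∪ᴱ restrict D Cu)
    cut-or-Cu x y in-X with F x y in Fxy
    ... | true  = refl
    ... | false = proj₂ (uncut-edge-in-u-component {X} {S} rec TX⊆T in-X Fxy)
    cut-only : X u ≡ false → restrict D X ⊆ᴱ F
    cut-only Xu x y in-X with F x y in Fxy
    ... | true  = refl
    ... | false = contradiction (trans (≡.sym Xu) (proj₁ (uncut-edge-in-u-component {X} {S} rec TX⊆T in-X Fxy)))
                                λ ()
    Cu⊆T : restrict TX Cu ⊆ᴱ T
    Cu⊆T i j = TX⊆T i j ∘ restrict-⊆ TX Cu i j
    by-position-of-u : q * countE (restrict D X) ≤ suc k * (p * h)
    by-position-of-u with X u in Xu
    ... | false = begin
      q * countE (restrict D X)  ≤⟨ *-monoʳ-≤ q (countE-mono (cut-only Xu)) ⟩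
      q * countE F               ≤⟨ F-bound ⟩
      p * h                      ≤⟨ m≤m+n (p * h) _ ⟩
      suc k * (p * h)            ∎
    ... | true = begin
      q * countE (restrict D X)                  ≤⟨ *-monoʳ-≤ q (countE-mono cut-or-Cu) ⟩
      q * countE (F ∪ᴱ restrict D Cu)            ≤⟨ *-monoʳ-≤ q (countE-∪ F (restrict D Cu)) ⟩
      q * (countE F + countE (restrict D Cu))    ≡⟨ *-distribˡ-+ q _ _ ⟩
      q * countE F + q * countE (restrict D Cu)  ≤⟨ +-mono-≤ F-bound Cu-bound ⟩
      p * h + k * (p * h)                        ∎
      where
      Cu-bound = crossing-bound k (rec Cu (reachable-isComponent (uncut G X S) Xu)) Cu⊆T
                   (depth-shrink k (component-small {G = G} Xu small-S small-X∖S) depth)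

lemma8 : Σ ℕ λ K → ∀ (n : ℕ) (G : Graph n) → ConnectedGraph G →
           (p q : ℕ) → 0 < q → (T : ESet n) → Out G p q full T →
           ∀ (h : ℕ) → IsHB G h →
           ∀ (u v : Fin n) → T u v ≡ true →
           ∀ (Su : VSet n) → (∀ w → (Su w ≡ true) ⇔ Path (removeEdge T u v) u w) →
           q * countE (crossing (adj G) Su) ≤ K * p * ⌈log₂ n ⌉ * h
-- As full is constantly true,
-- restrict D full reduces to D.
lemma8 = 2 , λ n G _ p q _ T out h hb u v _ Su side →
  subst (q * countE (crossing (adj G) Su) ≤_) (regroup ⌈log₂ n ⌉ p h)
    (CrossingBound.crossing-bound hb (crossing-⊆ (adj G) Su) (side-separates side) (2 * ⌈log₂ n ⌉) out
      (λ _ _ → id) (≤-trans (*-monoʳ-≤ (2 ^ (2 * ⌈log₂ n ⌉)) (size-≤ full)) (depth-bound n)))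
  where
  regroup : ∀ l p h → 2 * l * (p * h) ≡ 2 * p * l * h
  regroup = solve-∀
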